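{- Let $Q_4$ be the $4$-dimensional hypercube with vertex set $\{0,1\}^4$ (two vertices adjacent iff they differ in exactly one coordinate), rooted at $r=(0,0,0,0)$. Let $w^*$ be the weight function on $Q_4$ with $w^*(r)=0$ and $w^*(v)=4$ for every $v\ne r$. Then $w^*$ is a valid weight function on $Q_4$ rooted at $r$.
   Context: A configuration on a graph $G$ is a function $p:V(G)\to\mathbb{N}\cup\{0\}$ ($p(v)$ is the number of pebbles on $v$). A pebbling move from a vertex $u$ to an adjacent vertex $v$ removes two pebbles from $u$ and places one pebble on $v$. For a root $r$, a configuration $p$ is $r$-solvable if some (possibly empty) sequence of pebbling moves starting from $p$ places at least one pebble on $r$; otherwise it is $r$-unsolvable. A weight function is a function $w:V(G)\to\mathbb{R}_{\ge 0}$, and the weight of a configuration is $w(p)=\sum_{v\in V(G)}p(v)w(v)$. $1_G$ denotes the configuration with exactly one pebble on every vertex of $G$, so $w(1_G)=\sum_{v\in V(G)}w(v)$. A weight function $w$ on $G$ rooted at $r$ is valid if $r$ is the only vertex with weight $0$ and every $r$-unsolvable configuration $p$ satisfies $w(p)\le w(1_G)$. -}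

module Defs where

open import Data.Nat using (ℕ; zero; suc; _+_; _*_; _∸_; _≤_)
open import Data.Bool using (Bool; true; false; if_then_else_)
open import Data.Vec using (Vec; []; _∷_; replicate)
open import Data.List using (List; []; _∷_; map; _++_)
open import Data.Nat.ListAction using (sum)
open import Data.Product using (Σ; ∃; _×_; _,_)
open import Relation.Nullary using (¬_; does)
open import Relation.Binary.PropositionalEquality using (_≡_; _≢_)
import Data.Vec.Properties as VecP
import Data.Bool.Properties as BoolP

Vertex : ℕ → Set
Vertex n = Vec Bool n

_≟V_ : ∀ {n} → (u v : Vertex n) → Relation.Nullary.Dec (u ≡ v)
_≟V_ = VecP.≡-dec BoolP._≟_

hamming : ∀ {n} → Vertex n → Vertex n → ℕ
hamming [] [] = 0
hamming (a ∷ u) (b ∷ v) = (if does (a BoolP.≟ b) then 0 else 1) + hamming u v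

Adj : ∀ {n} → Vertex n → Vertex n → Set
Adj u v = hamming u v ≡ 1

allVertices : (n : ℕ) → List (Vertex n)
allVertices zero = [] ∷ []
allVertices (suc n) = map (false ∷_) (allVertices n) ++ map (true ∷_) (allVertices n)

Config : ℕ → Set
Config n = Vertex n → ℕ

WeightFn : ℕ → Set
WeightFn n = Vertex n → ℕ

weight : ∀ {n} → WeightFn n → Config n → ℕ
weight {n} w p = sum (map (λ v → p v * w v) (allVertices n))

one : ∀ {n} → Config n
one _ = 1

-- result of a pebbling move from u to v (u ≠ v, since adjacent)
moveResult : ∀ {n} → Config n → Vertex n → Vertex n → Config n
moveResult p u v x =
  if does (x ≟V u) then p x ∸ 2 else (if does (x ≟V v) then suc (p x) else p x)

data Move {n} (p : Config n) : Config n → Set where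
  move : (u v : Vertex n) → Adj u v → 2 ≤ p u → Move p (moveResult p u v)

data Reach {n} : Config n → Config n → Set where
  done : ∀ {p} → Reach p p
  step : ∀ {p q s} → Move p q → Reach q s → Reach p s

Solvable : ∀ {n} → Vertex n → Config n → Set
Solvable r p = Σ _ λ q → Reach p q × 1 ≤ q r

Valid : ∀ {n} → WeightFn n → Vertex n → Set
Valid {n} w r =
  (w r ≡ 0) × ((v : Vertex n) → v ≢ r → w v ≢ 0) ×
  ((p : Config n) → ¬ Solvable r p → weight w p ≤ weight w one)

root4 : Vertex 4
root4 = replicate 4 false

wStar : WeightFn 4
wStar v = if does (v ≟V root4) then 0 else 4

-- A configuration of weight more than w*(1) = 60 carries at least 16 pebbles.  Split Q₄ into
-- the 3-cube containing the root (first coordinate 0) and the opposite 3-cube, and use two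
-- facts about Q₃ due to Chung: its pebbling number is 8, and it has the 2-pebbling property,
-- i.e. Σ ⌈p(v)/2⌉ ≥ 9 suffices to put two pebbles on its root.  Either the root cube already
-- holds 8 pebbles; or the opposite cube moves two pebbles onto the neighbour of the root; or
-- Σ ⌈p(v)/2⌉ ≤ 8 on the opposite cube, and moving ⌊p(v)/2⌋ pebbles across every edge between
-- the cubes leaves at least 16 − 8 = 8 pebbles on the root cube.  The two facts about Q₃ are
-- checked by exhaustive search over the configurations with exactly 8, resp. minimal, pebbles.
{-# OPTIONS --safe #-}
module Submission where

open import Defs
open import Data.Bool using (Bool; true; false; T; _∧_; _∨_)
open import Data.Bool.Properties using (T-∧; T-∨; T-≡; ∧-conicalˡ; ∧-conicalʳ)
open import Data.Empty using (⊥-elim)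
open import Data.List using (List; []; _∷_; map; _++_)
open import Data.List.Properties using (map-++; map-∘; map-cong)
open import Data.List.Membership.Propositional.Properties using (∈-map⁻)
open import Data.List.Relation.Binary.Disjoint.Propositional using (Disjoint)
open import Data.List.Relation.Unary.All as All using (All; []; _∷_)
open import Data.List.Relation.Unary.AllPairs using ([]; _∷_)
open import Data.List.Relation.Unary.Unique.Propositional using (Unique)
import Data.List.Relation.Unary.Unique.Propositional.Properties as Unique
open import Data.Nat
open import Data.Nat.ListAction using (sum)
open import Data.Nat.ListAction.Properties using (sum-++)
open import Data.Nat.Properties
open import Algebra.Properties.CommutativeSemigroup +-commutativeSemigroup using (interchange)
open import Data.Product using (Σ-syntax; _×_; _,_)
open import Data.Sum using (inj₁; inj₂)
open import Data.Vec as Vec using (Vec; []; _∷_)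
open import Data.Vec.Properties using (∷-injectiveʳ)
open import Data.Vec.Relation.Binary.Pointwise.Inductive using (Pointwise; []; _∷_)
open import Function using (_∘_; id; Equivalence)
open import Relation.Nullary using (¬_; yes; no)
open import Relation.Binary.PropositionalEquality
  using (_≡_; _≢_; refl; sym; trans; cong; cong₂; module ≡-Reasoning)

open Equivalence using (to; from)

pattern O = false
pattern I = true

Reach-trans : ∀ {n} {p q s : Config n} → Reach p q → Reach q s → Reach p s
Reach-trans done       q↝s = q↝s
Reach-trans (step m r) q↝s = step m (Reach-trans r q↝s)

-- Places 1 r is exactly Solvable r.
Places : ∀ {n} → ℕ → Vertex n → Config n → Set
Places {n} k r p = Σ[ q ∈ Config n ] Reach p q × k ≤ q r

Places-prepend : ∀ {n k r} {p q : Config n} → Reach p q → Places k r q → Places k r p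
Places-prepend p↝q (s , q↝s , k≤) = s , Reach-trans p↝q q↝s , k≤

module Simulation {m n} (f : Vertex m → Vertex n)
                  (f-adj : ∀ u v → Adj u v → Adj (f u) (f v))
                  (f-injective : ∀ {x y} → f x ≡ f y → x ≡ y) where

  Dominated : Config m → Config n → Set
  Dominated p P = ∀ x → p x ≤ P (f x)

  moveResult-dominated : ∀ {p P} u v → Dominated p P →
                         Dominated (moveResult p u v) (moveResult P (f u) (f v))
  moveResult-dominated u v p≤P x with x ≟V u | f x ≟V f u
  ... | yes _   | yes _    = ∸-monoˡ-≤ 2 (p≤P x)
  ... | yes x≡u | no fx≢fu = ⊥-elim (fx≢fu (cong f x≡u))
  ... | no x≢u  | yes fx≡fu = ⊥-elim (x≢u (f-injective fx≡fu))
  ... | no _    | no _ with x ≟V v | f x ≟V f v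
  ...   | yes _   | yes _    = s≤s (p≤P x)
  ...   | yes x≡v | no fx≢fv = ⊥-elim (fx≢fv (cong f x≡v))
  ...   | no x≢v  | yes fx≡fv = ⊥-elim (x≢v (f-injective fx≡fv))
  ...   | no _    | no _     = p≤P x

  Reach-simulate : ∀ {p q P} → Dominated p P → Reach p q →
                   Σ[ Q ∈ Config n ] Reach P Q × Dominated q Q
  Reach-simulate {P = P} p≤P done = P , done , p≤P
  Reach-simulate {P = P} p≤P (step (move u v adj 2≤pu) p′↝q) =
    let Q , P′↝Q , q≤Q = Reach-simulate (moveResult-dominated {P = P} u v p≤P) p′↝q
    in  Q , step (move (f u) (f v) (f-adj u v adj) (≤-trans 2≤pu (p≤P u))) P′↝Q , q≤Q

  Places-simulate : ∀ {k r p P} → Dominated p P → Places k r p → Places k (f r) P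
  Places-simulate {r = r} p≤P (q , p↝q , k≤) =
    let Q , P↝Q , q≤Q = Reach-simulate p≤P p↝q in Q , P↝Q , ≤-trans k≤ (q≤Q r)

open Simulation using (Places-simulate)

Places-mono : ∀ {n k r} {p P : Config n} → (∀ x → p x ≤ P x) → Places k r p → Places k r P
Places-mono = Places-simulate id (λ _ _ → id) id

∷-adj : ∀ {n} b (u v : Vertex n) → Adj u v → Adj (b ∷ u) (b ∷ v)
∷-adj O u v adj = adj
∷-adj I u v adj = adj

face : ∀ {n} → Bool → Config (suc n) → Config n
face b p v = p (b ∷ v)

Places-face : ∀ {n k r} b (p : Config (suc n)) → Places k r (face b p) → Places k (b ∷ r) p
Places-face b p = Places-simulate (b ∷_) (∷-adj b) ∷-injectiveʳ (λ _ → ≤-refl)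

hamming-refl : ∀ {n} (v : Vertex n) → hamming v v ≡ 0
hamming-refl []      = refl
hamming-refl (O ∷ v) = hamming-refl v
hamming-refl (I ∷ v) = hamming-refl v

Adj-irrefl : ∀ {n} (u v : Vertex n) → Adj u v → u ≢ v
Adj-irrefl u .u adj refl with () ← trans (sym (hamming-refl u)) adj

Adj-across : ∀ {n} (v : Vertex n) → Adj (I ∷ v) (O ∷ v)
Adj-across v = cong suc (hamming-refl v)

moveResult-source : ∀ {n} (p : Config n) u v → moveResult p u v u ≡ p u ∸ 2
moveResult-source p u v with u ≟V u
... | yes _   = refl
... | no u≢u = ⊥-elim (u≢u refl)

moveResult-target : ∀ {n} (p : Config n) u v → u ≢ v → moveResult p u v v ≡ suc (p v)
moveResult-target p u v u≢v with v ≟V u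
... | yes v≡u = ⊥-elim (u≢v (sym v≡u))
... | no _ with v ≟V v
...   | yes _   = refl
...   | no v≢v = ⊥-elim (v≢v refl)

moveResult-≥ : ∀ {n} (p : Config n) u v x → x ≢ u → p x ≤ moveResult p u v x
moveResult-≥ p u v x x≢u with x ≟V u
... | yes x≡u = ⊥-elim (x≢u x≡u)
... | no _ with x ≟V v
...   | yes _ = n≤1+n (p x)
...   | no _  = ≤-refl

Places-move : ∀ {n} {u r : Vertex n} {p} → Adj u r → Places 2 u p → Places 1 r p
Places-move {u = u} {r} adj (q , p↝q , 2≤qu) =
  moveResult q u r , Reach-trans p↝q (step (move u r adj 2≤qu) done) ,
  ≤-trans (s≤s z≤n) (≤-reflexive (sym (moveResult-target q u r (Adj-irrefl u r adj))))

Halved : ∀ {n} → Config (suc n) → Config (suc n) → Vertex n → Set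
Halved p Q v = p (O ∷ v) + ⌊ p (I ∷ v) /2⌋ ≤ Q (O ∷ v)

halved-unmoved : ∀ {n} v (p : Config (suc n)) → ⌊ p (I ∷ v) /2⌋ ≡ 0 → Halved p p v
halved-unmoved v p ⌊p↑/2⌋≡0 = ≤-reflexive (trans (cong (p (O ∷ v) +_) ⌊p↑/2⌋≡0) (+-identityʳ _))

halveAt : ∀ {n} k (v : Vertex n) (p : Config (suc n)) → p (I ∷ v) ≡ k →
          Σ[ Q ∈ Config (suc n) ] Reach p Q × Halved p Q v × (∀ x → x ≢ I ∷ v → p x ≤ Q x)
halveAt zero          v p p↑≡ = p , done , halved-unmoved v p (cong ⌊_/2⌋ p↑≡) , λ _ _ → ≤-refl
halveAt (suc zero)    v p p↑≡ = p , done , halved-unmoved v p (cong ⌊_/2⌋ p↑≡) , λ _ _ → ≤-refl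
halveAt (suc (suc k)) v p p↑≡ =
  let Q , p′↝Q , halved , kept = halveAt k v p′ p′↑≡
  in  Q , step (move (I ∷ v) (O ∷ v) (Adj-across v) 2≤p↑) p′↝Q ,
      ≤-trans (≤-reflexive same-total) halved ,
      λ x x≢ → ≤-trans (moveResult-≥ p (I ∷ v) (O ∷ v) x x≢) (kept x x≢)
  where
  open ≡-Reasoning
  p′ = moveResult p (I ∷ v) (O ∷ v)
  2≤p↑ : 2 ≤ p (I ∷ v)
  2≤p↑ = ≤-trans (s≤s (s≤s z≤n)) (≤-reflexive (sym p↑≡))
  p′↑≡ : p′ (I ∷ v) ≡ k
  p′↑≡ = trans (moveResult-source p (I ∷ v) (O ∷ v)) (cong (_∸ 2) p↑≡)
  same-total : p (O ∷ v) + ⌊ p (I ∷ v) /2⌋ ≡ p′ (O ∷ v) + ⌊ p′ (I ∷ v) /2⌋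
  same-total = begin
    p (O ∷ v) + ⌊ p (I ∷ v) /2⌋   ≡⟨ cong (λ z → p (O ∷ v) + ⌊ z /2⌋) p↑≡ ⟩
    p (O ∷ v) + suc ⌊ k /2⌋       ≡⟨ +-suc (p (O ∷ v)) ⌊ k /2⌋ ⟩
    suc (p (O ∷ v)) + ⌊ k /2⌋     ≡⟨ cong₂ (λ a b → a + ⌊ b /2⌋)
                                           (sym (moveResult-target p (I ∷ v) (O ∷ v) (λ ())))
                                           (sym p′↑≡) ⟩
    p′ (O ∷ v) + ⌊ p′ (I ∷ v) /2⌋ ∎

halveAll : ∀ {n} (vs : List (Vertex n)) → Unique vs → (p : Config (suc n)) →
           Σ[ Q ∈ Config (suc n) ] Reach p Q × All (Halved p Q) vs ×
             (∀ x → All (λ w → x ≢ I ∷ w) vs → p x ≤ Q x)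
halveAll [] [] p = p , done , [] , λ _ _ → ≤-refl
halveAll (v ∷ vs) (v∉vs ∷ unique) p with halveAt _ v p refl
... | Q₁ , p↝Q₁ , halved₁ , kept₁ with halveAll vs unique Q₁
...   | Q , Q₁↝Q , halved , kept =
  Q , Reach-trans p↝Q₁ Q₁↝Q ,
  ≤-trans halved₁ (kept (O ∷ v) (All.universal (λ _ ()) vs)) ∷ still-halved v∉vs halved ,
  λ { x (x≢v ∷ x≢vs) → ≤-trans (kept₁ x x≢v) (kept x x≢vs) }
  where
  still-halved : ∀ {ws} → All (v ≢_) ws → All (Halved Q₁ Q) ws → All (Halved p Q) ws
  still-halved [] [] = []
  still-halved {w ∷ _} (v≢w ∷ v∉ws) (h ∷ hs) =
    ≤-trans (+-mono-≤ (kept₁ (O ∷ w) (λ ()))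
                      (⌊n/2⌋-mono (kept₁ (I ∷ w) (v≢w ∘ sym ∘ ∷-injectiveʳ)))) h
    ∷ still-halved v∉ws hs

allVertices-unique : ∀ n → Unique (allVertices n)
allVertices-unique zero    = [] ∷ []
allVertices-unique (suc n) =
  Unique.++⁺ (Unique.map⁺ ∷-injectiveʳ unique) (Unique.map⁺ ∷-injectiveʳ unique) disjoint
  where
  unique = allVertices-unique n
  disjoint : Disjoint (map (O ∷_) (allVertices n)) (map (I ∷_) (allVertices n))
  disjoint (x∈O , x∈I) with ∈-map⁻ (O ∷_) x∈O | ∈-map⁻ (I ∷_) x∈I
  ... | _ , _ , refl | _ , _ , ()

halve : ∀ {n} (p : Config (suc n)) →
        Σ[ Q ∈ Config (suc n) ] Reach p Q × All (Halved p Q) (allVertices n)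
halve {n} p with halveAll (allVertices n) (allVertices-unique n) p
... | Q , p↝Q , halved , _ = Q , p↝Q , halved

module _ {A : Set} where

  sum-map-mono : ∀ {f g : A → ℕ} {xs} → All (λ x → f x ≤ g x) xs → sum (map f xs) ≤ sum (map g xs)
  sum-map-mono []       = z≤n
  sum-map-mono (h ∷ hs) = +-mono-≤ h (sum-map-mono hs)

  sum-map-+ : ∀ (f g : A → ℕ) xs → sum (map (λ x → f x + g x) xs) ≡ sum (map f xs) + sum (map g xs)
  sum-map-+ f g []       = refl
  sum-map-+ f g (x ∷ xs) =
    trans (cong (f x + g x +_) (sum-map-+ f g xs)) (interchange (f x) (g x) _ _)

  sum-map-*ʳ : ∀ (f : A → ℕ) k xs → sum (map (λ x → f x * k) xs) ≡ sum (map f xs) * k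
  sum-map-*ʳ f k []       = refl
  sum-map-*ʳ f k (x ∷ xs) =
    trans (cong (f x * k +_) (sum-map-*ʳ f k xs)) (sym (*-distribʳ-+ k (f x) _))

size : ∀ {n} → Config n → ℕ
size {n} p = sum (map p (allVertices n))

size-faces : ∀ {n} (p : Config (suc n)) → size p ≡ size (face O p) + size (face I p)
size-faces {n} p = begin
  sum (map p (map (O ∷_) vs ++ map (I ∷_) vs))
    ≡⟨ cong sum (map-++ p (map (O ∷_) vs) (map (I ∷_) vs)) ⟩
  sum (map p (map (O ∷_) vs) ++ map p (map (I ∷_) vs))
    ≡⟨ sum-++ (map p (map (O ∷_) vs)) (map p (map (I ∷_) vs)) ⟩
  sum (map p (map (O ∷_) vs)) + sum (map p (map (I ∷_) vs))
    ≡⟨ sym (cong₂ _+_ (cong sum (map-∘ vs)) (cong sum (map-∘ vs))) ⟩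
  size (face O p) + size (face I p) ∎
  where
  open ≡-Reasoning
  vs = allVertices n

size-halves : ∀ {n} (p : Config n) → size p ≡ size (⌊_/2⌋ ∘ p) + size (⌈_/2⌉ ∘ p)
size-halves {n} p =
  trans (cong sum (map-cong (sym ∘ ⌊n/2⌋+⌈n/2⌉≡n ∘ p) (allVertices n)))
        (sum-map-+ (⌊_/2⌋ ∘ p) (⌈_/2⌉ ∘ p) (allVertices n))

size-halved : ∀ {n} (p Q : Config (suc n)) → All (Halved p Q) (allVertices n) →
                size (face O p) + size (⌊_/2⌋ ∘ face I p) ≤ size (face O Q)
size-halved {n} p Q halved = begin
  size (face O p) + size (⌊_/2⌋ ∘ face I p)
    ≡⟨ sym (sum-map-+ (face O p) (⌊_/2⌋ ∘ face I p) (allVertices n)) ⟩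
  sum (map (λ v → p (O ∷ v) + ⌊ p (I ∷ v) /2⌋) (allVertices n))
    ≤⟨ sum-map-mono halved ⟩
  size (face O Q) ∎
  where open ≤-Reasoning

Table : Set
Table = Vec ℕ 8

pattern ⟨_,_,_⟩ a b c = a ∷ b ∷ c ∷ []

root3 : Vertex 3
root3 = ⟨ O , O , O ⟩

lookup3 : Table → Config 3
lookup3 (a ∷ _ ∷ _ ∷ _ ∷ _ ∷ _ ∷ _ ∷ _ ∷ []) ⟨ O , O , O ⟩ = a
lookup3 (_ ∷ b ∷ _ ∷ _ ∷ _ ∷ _ ∷ _ ∷ _ ∷ []) ⟨ O , O , I ⟩ = b
lookup3 (_ ∷ _ ∷ c ∷ _ ∷ _ ∷ _ ∷ _ ∷ _ ∷ []) ⟨ O , I , O ⟩ = c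
lookup3 (_ ∷ _ ∷ _ ∷ d ∷ _ ∷ _ ∷ _ ∷ _ ∷ []) ⟨ O , I , I ⟩ = d
lookup3 (_ ∷ _ ∷ _ ∷ _ ∷ e ∷ _ ∷ _ ∷ _ ∷ []) ⟨ I , O , O ⟩ = e
lookup3 (_ ∷ _ ∷ _ ∷ _ ∷ _ ∷ f ∷ _ ∷ _ ∷ []) ⟨ I , O , I ⟩ = f
lookup3 (_ ∷ _ ∷ _ ∷ _ ∷ _ ∷ _ ∷ g ∷ _ ∷ []) ⟨ I , I , O ⟩ = g
lookup3 (_ ∷ _ ∷ _ ∷ _ ∷ _ ∷ _ ∷ _ ∷ h ∷ []) ⟨ I , I , I ⟩ = h

-- The entries are listed in the order of allVertices 3, so that Vec.sum (tabulate3 p) and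
-- size p are the same sum.
tabulate3 : Config 3 → Table
tabulate3 p = p ⟨ O , O , O ⟩ ∷ p ⟨ O , O , I ⟩ ∷ p ⟨ O , I , O ⟩ ∷ p ⟨ O , I , I ⟩ ∷
              p ⟨ I , O , O ⟩ ∷ p ⟨ I , O , I ⟩ ∷ p ⟨ I , I , O ⟩ ∷ p ⟨ I , I , I ⟩ ∷ []

lookup3-tabulate3 : ∀ p x → lookup3 (tabulate3 p) x ≡ p x
lookup3-tabulate3 p ⟨ O , O , O ⟩ = refl
lookup3-tabulate3 p ⟨ O , O , I ⟩ = refl
lookup3-tabulate3 p ⟨ O , I , O ⟩ = refl
lookup3-tabulate3 p ⟨ O , I , I ⟩ = refl
lookup3-tabulate3 p ⟨ I , O , O ⟩ = refl
lookup3-tabulate3 p ⟨ I , O , I ⟩ = refl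
lookup3-tabulate3 p ⟨ I , I , O ⟩ = refl
lookup3-tabulate3 p ⟨ I , I , I ⟩ = refl

lookup3-mono : ∀ {s t} → Pointwise _≤_ s t → ∀ x → lookup3 s x ≤ lookup3 t x
lookup3-mono (a ∷ _ ∷ _ ∷ _ ∷ _ ∷ _ ∷ _ ∷ _ ∷ []) ⟨ O , O , O ⟩ = a
lookup3-mono (_ ∷ b ∷ _ ∷ _ ∷ _ ∷ _ ∷ _ ∷ _ ∷ []) ⟨ O , O , I ⟩ = b
lookup3-mono (_ ∷ _ ∷ c ∷ _ ∷ _ ∷ _ ∷ _ ∷ _ ∷ []) ⟨ O , I , O ⟩ = c
lookup3-mono (_ ∷ _ ∷ _ ∷ d ∷ _ ∷ _ ∷ _ ∷ _ ∷ []) ⟨ O , I , I ⟩ = d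
lookup3-mono (_ ∷ _ ∷ _ ∷ _ ∷ e ∷ _ ∷ _ ∷ _ ∷ []) ⟨ I , O , O ⟩ = e
lookup3-mono (_ ∷ _ ∷ _ ∷ _ ∷ _ ∷ f ∷ _ ∷ _ ∷ []) ⟨ I , O , I ⟩ = f
lookup3-mono (_ ∷ _ ∷ _ ∷ _ ∷ _ ∷ _ ∷ g ∷ _ ∷ []) ⟨ I , I , O ⟩ = g
lookup3-mono (_ ∷ _ ∷ _ ∷ _ ∷ _ ∷ _ ∷ _ ∷ h ∷ []) ⟨ I , I , I ⟩ = h

Arc : Set
Arc = Σ[ u ∈ Vertex 3 ] Σ[ v ∈ Vertex 3 ] Adj u v

-- The search only uses moves that decrease the distance to root3; soundness does not depend
-- on this choice.
inwardArcs : List Arc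
inwardArcs =
  (⟨ O , O , I ⟩ , ⟨ O , O , O ⟩ , refl) ∷
  (⟨ O , I , O ⟩ , ⟨ O , O , O ⟩ , refl) ∷
  (⟨ O , I , I ⟩ , ⟨ O , I , O ⟩ , refl) ∷
  (⟨ O , I , I ⟩ , ⟨ O , O , I ⟩ , refl) ∷
  (⟨ I , O , O ⟩ , ⟨ O , O , O ⟩ , refl) ∷
  (⟨ I , O , I ⟩ , ⟨ I , O , O ⟩ , refl) ∷
  (⟨ I , O , I ⟩ , ⟨ O , O , I ⟩ , refl) ∷
  (⟨ I , I , O ⟩ , ⟨ I , O , O ⟩ , refl) ∷
  (⟨ I , I , O ⟩ , ⟨ O , I , O ⟩ , refl) ∷
  (⟨ I , I , I ⟩ , ⟨ I , I , O ⟩ , refl) ∷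
  (⟨ I , I , I ⟩ , ⟨ I , O , I ⟩ , refl) ∷
  (⟨ I , I , I ⟩ , ⟨ O , I , I ⟩ , refl) ∷ []

canPlace : (fuel k : ℕ) → Table → Bool
tryArcs  : (fuel k : ℕ) → Table → List Arc → Bool
canPlace zero       k t = k ≤ᵇ lookup3 t root3
canPlace (suc fuel) k t = (k ≤ᵇ lookup3 t root3) ∨ tryArcs fuel k t inwardArcs
tryArcs fuel k t [] = false
tryArcs fuel k t ((u , v , _) ∷ arcs) =
  ((2 ≤ᵇ lookup3 t u) ∧ canPlace fuel k (tabulate3 (moveResult (lookup3 t) u v)))
  ∨ tryArcs fuel k t arcs

canPlace-sound : ∀ fuel k t → T (canPlace fuel k t) → Places k root3 (lookup3 t)
tryArcs-sound  : ∀ fuel k t arcs → T (tryArcs fuel k t arcs) → Places k root3 (lookup3 t)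
canPlace-sound zero       k t k≤ = lookup3 t , done , ≤ᵇ⇒≤ k _ k≤
canPlace-sound (suc fuel) k t ok with to (T-∨ {k ≤ᵇ lookup3 t root3}) ok
... | inj₁ k≤ = lookup3 t , done , ≤ᵇ⇒≤ k _ k≤
... | inj₂ ok′ = tryArcs-sound fuel k t inwardArcs ok′
tryArcs-sound fuel k t ((u , v , adj) ∷ arcs) ok with to (T-∨ {(2 ≤ᵇ lookup3 t u) ∧ _}) ok
... | inj₂ ok′ = tryArcs-sound fuel k t arcs ok′
... | inj₁ ok′ with to (T-∧ {2 ≤ᵇ lookup3 t u}) ok′
...   | 2≤ , placed =
  Places-prepend (step (move u v adj (≤ᵇ⇒≤ 2 _ 2≤)) done)
    (Places-mono (≤-reflexive ∘ lookup3-tabulate3 _) (canPlace-sound fuel k _ placed))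

all≤ : ℕ → (ℕ → Bool) → Bool
all≤ zero    g = g 0
all≤ (suc n) g = g (suc n) ∧ all≤ n g

all≤-sound : ∀ n g → all≤ n g ≡ true → ∀ i → i ≤ n → g i ≡ true
all≤-sound zero    g ok .0 z≤n = ok
all≤-sound (suc n) g ok i i≤ with i ≟ suc n
... | yes refl = ∧-conicalˡ (g (suc n)) _ ok
... | no i≢    = all≤-sound n g (∧-conicalʳ (g (suc n)) _ ok) i (≤-pred (≤∧≢⇒< i≤ i≢))

allOfSum : (k n : ℕ) → (Vec ℕ k → Bool) → Bool
allOfSum zero    zero    f = f []
allOfSum zero    (suc n) f = true
allOfSum (suc k) n       f = all≤ n (λ i → allOfSum k (n ∸ i) (λ xs → f (i ∷ xs)))

-- Stated with ≡ true rather than T: Agda checks refl against the former far faster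
-- than tt against the latter.
allOfSum-sound : ∀ k n f → allOfSum k n f ≡ true → ∀ xs → Vec.sum xs ≡ n → T (f xs)
allOfSum-sound zero    .0 f ok []       refl = from (T-≡ {f []}) ok
allOfSum-sound (suc k) n  f ok (x ∷ xs) refl =
  allOfSum-sound k (n ∸ x) (λ xs → f (x ∷ xs))
    (all≤-sound n (λ i → allOfSum k (n ∸ i) (λ xs → f (i ∷ xs))) ok x (m≤m+n x (Vec.sum xs)))
    xs (sym (m+n∸m≡n x (Vec.sum xs)))

shrink : ∀ {k} n (xs : Vec ℕ k) → n ≤ Vec.sum xs →
         Σ[ ys ∈ Vec ℕ k ] Vec.sum ys ≡ n × Pointwise _≤_ ys xs
shrink .0 [] z≤n = [] , refl , []
shrink n (x ∷ xs) n≤ =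
  let ys , Σys≡ , ys≤xs = shrink (n ∸ x) xs (m≤n+o⇒m∸n≤o n x n≤)
  in  x ⊓ n ∷ ys , trans (cong (x ⊓ n +_) Σys≡) (m⊓n+n∸m≡n x n) , m⊓n≤m x n ∷ ys≤xs

Q3-pebbling-check : allOfSum 8 8 (canPlace 20 1) ≡ true
Q3-pebbling-check = refl

Q3-pebbling : ∀ p → 8 ≤ size p → Places 1 root3 p
Q3-pebbling p 8≤ with shrink 8 (tabulate3 p) 8≤
... | t , Σt≡8 , t≤p =
  Places-mono (λ x → ≤-trans (lookup3-mono t≤p x) (≤-reflexive (lookup3-tabulate3 p x)))
              (canPlace-sound 20 1 t
                 (allOfSum-sound 8 8 (canPlace 20 1) Q3-pebbling-check t Σt≡8))

2*⌈n/2⌉≤1+n : ∀ n → 2 * ⌈ n /2⌉ ≤ suc n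
2*⌈n/2⌉≤1+n zero          = z≤n
2*⌈n/2⌉≤1+n (suc zero)    = ≤-refl
2*⌈n/2⌉≤1+n (suc (suc n)) = begin
  2 * suc ⌈ n /2⌉     ≡⟨ *-suc 2 ⌈ n /2⌉ ⟩
  2 + 2 * ⌈ n /2⌉     ≤⟨ +-monoʳ-≤ 2 (2*⌈n/2⌉≤1+n n) ⟩
  suc (suc (suc n))   ∎
  where open ≤-Reasoning

oddFromHalves : ∀ {k} → Vec ℕ k → Vec ℕ k
oddFromHalves = Vec.map (λ d → 2 * d ∸ 1)

oddFromHalves-≤ : ∀ {k} {ds xs : Vec ℕ k} → Pointwise _≤_ ds (Vec.map ⌈_/2⌉ xs) →
                  Pointwise _≤_ (oddFromHalves ds) xs
oddFromHalves-≤ {ds = []}    {[]}     []         = []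
oddFromHalves-≤ {ds = d ∷ _} {x ∷ _} (d≤ ∷ ds≤) =
  ≤-trans (∸-monoˡ-≤ 1 (*-monoʳ-≤ 2 d≤)) (∸-monoˡ-≤ 1 (2*⌈n/2⌉≤1+n x)) ∷ oddFromHalves-≤ ds≤

-- A configuration with Σ ⌈p(v)/2⌉ ≥ 9 dominates one with 2 d(v) − 1 pebbles on each v,
-- for some d with Σ d = 9; there are finitely many of these.
Q3-twoPebbling-check : allOfSum 8 9 (λ ds → canPlace 20 2 (oddFromHalves ds)) ≡ true
Q3-twoPebbling-check = refl

Q3-twoPebbling : ∀ p → 9 ≤ size (⌈_/2⌉ ∘ p) → Places 2 root3 p
Q3-twoPebbling p 9≤ with shrink 9 (Vec.map ⌈_/2⌉ (tabulate3 p)) 9≤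
... | ds , Σds≡9 , ds≤ =
  Places-mono (λ x → ≤-trans (lookup3-mono (oddFromHalves-≤ ds≤) x)
                             (≤-reflexive (lookup3-tabulate3 p x)))
              (canPlace-sound 20 2 (oddFromHalves ds)
                 (allOfSum-sound 8 9 (λ ds → canPlace 20 2 (oddFromHalves ds))
                                 Q3-twoPebbling-check ds Σds≡9))

Q4-pebbling : ∀ p → 16 ≤ size p → Places 1 root4 p
Q4-pebbling p 16≤ with 8 ≤? size (face O p) | 9 ≤? size (⌈_/2⌉ ∘ face I p)
... | yes 8≤ | _      = Places-face O p (Q3-pebbling (face O p) 8≤)
... | no _   | yes 9≤ = Places-move refl (Places-face I p (Q3-twoPebbling (face I p) 9≤))
... | no _   | no 9≰ = from-halving (halve p)
  where
  open ≤-Reasoning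
  A = size (face O p)
  F = size (⌊_/2⌋ ∘ face I p)
  C = size (⌈_/2⌉ ∘ face I p)
  8≤ : 8 ≤ A + F
  8≤ = +-cancelʳ-≤ 8 8 (A + F) (begin
    16                   ≤⟨ 16≤ ⟩
    size p               ≡⟨ size-faces p ⟩
    A + size (face I p)  ≡⟨ cong (A +_) (size-halves (face I p)) ⟩
    A + (F + C)          ≡⟨ sym (+-assoc A F C) ⟩
    A + F + C            ≤⟨ +-monoʳ-≤ (A + F) (≤-pred (≰⇒> 9≰)) ⟩
    A + F + 8            ∎)
  -- Matching on halve p with a with-clause would make Agda normalise it.
  from-halving : Σ[ Q ∈ Config 4 ] Reach p Q × All (Halved p Q) (allVertices 3) →
                 Places 1 root4 p
  from-halving (Q , p↝Q , halved) =
    Places-prepend p↝Q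
      (Places-face O Q (Q3-pebbling (face O Q) (≤-trans 8≤ (size-halved p Q halved))))

wStar≤4 : ∀ v → wStar v ≤ 4
wStar≤4 v with v ≟V root4
... | yes _ = z≤n
... | no _  = ≤-refl

weight-wStar≤ : ∀ p → weight wStar p ≤ size p * 4
weight-wStar≤ p = begin
  weight wStar p
    ≤⟨ sum-map-mono (All.universal (λ v → *-monoʳ-≤ (p v) (wStar≤4 v)) vs) ⟩
  sum (map (λ v → p v * 4) vs)
    ≡⟨ sum-map-*ʳ p 4 vs ⟩
  size p * 4 ∎
  where
  open ≤-Reasoning
  vs = allVertices 4

theorem2 : Valid wStar root4
theorem2 = refl , wStar-positive , unsolvable-light
  where
  wStar-positive : (v : Vertex 4) → v ≢ root4 → wStar v ≢ 0
  wStar-positive v v≢r with v ≟V root4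
  ... | yes v≡r = ⊥-elim (v≢r v≡r)
  ... | no _    = λ ()
  unsolvable-light : (p : Config 4) → ¬ Solvable root4 p → weight wStar p ≤ weight wStar one
  unsolvable-light p unsolvable with weight wStar p ≤? weight wStar one
  ... | yes light = light
  ... | no heavy  = ⊥-elim (unsolvable (Q4-pebbling p 16≤))
    where
    16≤ : 16 ≤ size p
    16≤ = *-cancelʳ-< 4 15 (size p) (<-≤-trans (≰⇒> heavy) (weight-wStar≤ p))
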